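{- Let $G$ be a $(P_6,C_4)$-free graph, and let $X$, $Y$ and $\{c\}$ be disjoint subsets of $V(G)$ such that: (i) $Y$ is a clique, and every vertex in $X$ has a neighbor in $Y$; (ii) $c$ is adjacent to every vertex of $X$ and to no vertex of $Y$; (iii) either $G[X]$ is not connected, or there are vertices $c',c''\in V(G)\setminus (X\cup Y)$ such that $c'$ is adjacent to every vertex of $Y$ and to no vertex of $X$, $c''$ has no neighbor in $X\cup Y$, and $c'c''\in E(G)$. Then $G[X]$ is $(P_4,2P_3)$-free.
   Context: Graphs are finite and simple. $P_\ell$ is the path on $\ell$ vertices, $C_4$ the cycle on 4 vertices, and $2P_3$ the disjoint union of two copies of $P_3$. $\mathcal F$-free means no induced subgraph isomorphic to a member of $\mathcal F$. $G[S]$ denotes the subgraph induced by $S$. -}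

module Defs where

open import Data.Nat using (ℕ; zero; suc)
open import Data.Bool using (Bool; true; false; _∨_; _∧_; not)
open import Data.Bool.Properties using (∨-comm)
open import Data.Fin using (Fin; toℕ)
open import Data.Fin.Subset using (Subset; _∈_; _∉_)
open import Data.Product using (Σ; _×_)
open import Function.Definitions using (Injective)
open import Relation.Binary.PropositionalEquality using (_≡_; refl; cong; cong₂)
open import Relation.Nullary using (¬_)

record Graph (n : ℕ) : Set where
  field
    adj    : Fin n → Fin n → Bool
    sym    : ∀ u v → adj u v ≡ adj v u
    irrefl : ∀ v → adj v v ≡ false
open Graph public

eqℕ : ℕ → ℕ → Bool
eqℕ zero zero = true
eqℕ zero (suc _) = false
eqℕ (suc _) zero = false
eqℕ (suc i) (suc j) = eqℕ i j

eqℕ-sym : ∀ i j → eqℕ i j ≡ eqℕ j i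
eqℕ-sym zero zero = refl
eqℕ-sym zero (suc _) = refl
eqℕ-sym (suc _) zero = refl
eqℕ-sym (suc i) (suc j) = eqℕ-sym i j

eqℕ-refl : ∀ i → eqℕ i i ≡ true
eqℕ-refl zero = refl
eqℕ-refl (suc i) = eqℕ-refl i

mkGraph : (k : ℕ) → (Fin k → Fin k → Bool) → Graph k
mkGraph k e = record
  { adj = λ i j → not (eqℕ (toℕ i) (toℕ j)) ∧ (e i j ∨ e j i)
  ; sym = λ i j → cong₂ (λ a b → not a ∧ b) (eqℕ-sym (toℕ i) (toℕ j)) (∨-comm (e i j) (e j i))
  ; irrefl = λ i → cong (λ a → not a ∧ (e i i ∨ e i i)) (eqℕ-refl (toℕ i)) }

P : (ℓ : ℕ) → Graph ℓ
P ℓ = mkGraph ℓ (λ i j → eqℕ (suc (toℕ i)) (toℕ j))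

C4 : Graph 4
C4 = mkGraph 4 (λ i j → eqℕ (suc (toℕ i)) (toℕ j) ∨ (eqℕ (toℕ i) 0 ∧ eqℕ (toℕ j) 3))

-- 2P_3 on vertices 0,…,5, with edges 01, 12, 34, 45.
twoP3 : Graph 6
twoP3 = mkGraph 6 (λ i j → eqℕ (suc (toℕ i)) (toℕ j) ∧ not (eqℕ (toℕ i) 2))

All : ∀ {n} → Subset n
All = Data.Fin.Subset.⊤

InducedIn : ∀ {n k} → Graph n → Subset n → Graph k → Set
InducedIn {n} {k} G S H =
  Σ (Fin k → Fin n) λ f →
    Injective _≡_ _≡_ f × (∀ i → f i ∈ S) × (∀ i j → adj G (f i) (f j) ≡ adj H i j)

FreeIn : ∀ {n k} → Graph n → Subset n → Graph k → Set
FreeIn G S H = ¬ InducedIn G S H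

Free : ∀ {n k} → Graph n → Graph k → Set
Free G H = FreeIn G All H

-- Walks inside S: Reach G S u v means v can be reached from u by a walk
-- whose vertices after u all lie in S.
data Reach {n} (G : Graph n) (S : Subset n) : Fin n → Fin n → Set where
  here : ∀ {u} → Reach G S u u
  step : ∀ {u w v} → adj G u w ≡ true → w ∈ S → Reach G S w v → Reach G S u v

Connected : ∀ {n} → Graph n → Subset n → Set
Connected G S = ∀ u v → u ∈ S → v ∈ S → Reach G S u v

module Submission where

-- The one use of C4-freeness: if x ≁ x′ in X and y ∈ Y sees x, then y does
-- not see x′ (else x′ c x y is a C4).  Hence the Y-neighbours y, y′ of two
-- far-apart vertices of X are distinct and adjacent (Y is a clique), and
-- the induced paths of X get extended through y y′ into induced P6's.
--   * 2P3: the two P3's together with y, y′ always contain an induced P6.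
--   * P4:  any edge ab anticomplete to the P4, with b complete and a
--     anticomplete to the Y-neighbours of its ends, closes an induced P6 or
--     a C4.  The edge c″c′ is such an edge; and so would be z·(Y-neighbour
--     of z) for any z ∈ X anticomplete to the P4.  So the P4 dominates X,
--     which makes G[X] connected.

open import Defs
open import Data.Nat using (s≤s)
open import Data.Bool using (true; false)
open import Data.Bool.Properties using (¬-not) renaming (_≟_ to _≟ᵇ_)
open import Data.Fin using (Fin; zero; suc; _<_)
open import Data.Fin.Properties using (any?; all?; <-cmp) renaming (_≟_ to _≟ᶠ_)
open import Data.Fin.Subset using (Subset; _∈_; _∉_)
open import Data.Fin.Subset.Properties using (∈⊤)
open import Data.Vec using ([]; _∷_; lookup)
open import Data.Product using (Σ; ∃; _×_; _,_; proj₁; proj₂)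
open import Data.Sum using (_⊎_; inj₁; inj₂)
open import Data.Empty using (⊥; ⊥-elim)
open import Function using (case_of_)
open import Function.Definitions using (Injective)
open import Relation.Binary.Definitions using (tri<; tri≈; tri>)
open import Relation.Binary.PropositionalEquality
  using (_≡_; _≢_; refl; trans; cong; ≢-sym; module ≡-Reasoning) renaming (sym to ≡-sym)
open import Relation.Nullary using (¬_; Dec; yes; no)
open import Relation.Nullary.Decidable using (¬?; _⊎-dec_; _→-dec_; from-yes)

Distinguishable : ∀ {k} → Graph k → Fin k → Fin k → Set
Distinguishable H i j = adj H i j ≡ true ⊎ ∃ λ l → adj H i l ≢ adj H j l

distinguishable? : ∀ {k} (H : Graph k) i j → Dec (Distinguishable H i j)
distinguishable? H i j =
  (adj H i j ≟ᵇ true) ⊎-dec any? (λ l → ¬? (adj H i l ≟ᵇ adj H j l))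

TwinFree : ∀ {k} → Graph k → Set
TwinFree H = ∀ i j → i ≢ j → Distinguishable H i j

twinFree? : ∀ {k} (H : Graph k) → Dec (TwinFree H)
twinFree? H = all? λ i → all? λ j → ¬? (i ≟ᶠ j) →-dec distinguishable? H i j

P6-twinFree : TwinFree (P 6)
P6-twinFree = from-yes (twinFree? (P 6))

-- C4 is not twin-free: its only undistinguishable pairs are opposite corners.
opposite : Fin 4 → Fin 4
opposite zero = suc (suc zero)
opposite (suc zero) = suc (suc (suc zero))
opposite (suc (suc zero)) = zero
opposite (suc (suc (suc zero))) = suc zero

C4-twins : ∀ i j → i ≢ j → Distinguishable C4 i j ⊎ j ≡ opposite i
C4-twins = from-yes (all? λ i → all? λ j →
  ¬? (i ≟ᶠ j) →-dec (distinguishable? C4 i j ⊎-dec (j ≟ᶠ opposite i)))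

P4-no-isolated : ∀ i → ∃ λ j → adj (P 4) j i ≡ true
P4-no-isolated = from-yes (all? λ i → any? λ j → adj (P 4) j i ≟ᵇ true)

module _ {n} (G : Graph n) where

  adj-sym : ∀ {u v b} → adj G u v ≡ b → adj G v u ≡ b
  adj-sym {u} {v} uv = trans (sym G v u) uv

  separated : ∀ {w u v} → adj G w u ≡ true → adj G w v ≡ false → u ≢ v
  separated wu wv refl = case trans (≡-sym wu) wv of λ ()

  Preserves : ∀ {k} → Graph k → (Fin k → Fin n) → Set
  Preserves H f = ∀ i j → adj G (f i) (f j) ≡ adj H i j

  -- By symmetry and irreflexivity it suffices to check the pairs i < j.
  preserves-from-upper : ∀ {k} (H : Graph k) (f : Fin k → Fin n) →
    (∀ i j → i < j → adj G (f i) (f j) ≡ adj H i j) → Preserves H f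
  preserves-from-upper H f upper i j with <-cmp i j
  ... | tri< i<j _ _ = upper i j i<j
  ... | tri≈ _ refl _ = trans (irrefl G (f i)) (≡-sym (irrefl H i))
  ... | tri> _ _ j<i = trans (sym G (f i) (f j)) (trans (upper j i j<i) (sym H j i))

  preserves-apart : ∀ {k} {H : Graph k} {f : Fin k → Fin n} → Preserves H f →
    ∀ {i j} → Distinguishable H i j → f i ≢ f j
  preserves-apart {H = H} {f} pres {i} {j} (inj₁ i~j) eq = case true≡false of λ ()
    where
    open ≡-Reasoning
    true≡false : true ≡ false
    true≡false = begin
      true              ≡⟨ ≡-sym i~j ⟩
      adj H i j         ≡⟨ ≡-sym (pres i j) ⟩
      adj G (f i) (f j) ≡⟨ cong (adj G (f i)) (≡-sym eq) ⟩
      adj G (f i) (f i) ≡⟨ irrefl G (f i) ⟩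
      false             ∎
  preserves-apart {H = H} {f} pres {i} {j} (inj₂ (l , differ)) eq = differ (begin
      adj H i l         ≡⟨ ≡-sym (pres i l) ⟩
      adj G (f i) (f l) ≡⟨ cong (λ u → adj G u (f l)) eq ⟩
      adj G (f j) (f l) ≡⟨ pres j l ⟩
      adj H j l         ∎)
    where open ≡-Reasoning

  induced-copy : ∀ {k} (H : Graph k) (f : Fin k → Fin n) → Preserves H f →
    (∀ {i j} → i ≢ j → ¬ Distinguishable H i j → f i ≢ f j) →
    InducedIn G All H
  induced-copy H f pres twins-apart = f , injective , (λ _ → ∈⊤) , pres
    where
    injective : Injective _≡_ _≡_ f
    injective {i} {j} eq with i ≟ᶠ j
    ... | yes i≡j = i≡j
    ... | no i≢j with distinguishable? H i j
    ...   | yes d = ⊥-elim (preserves-apart {H = H} pres d eq)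
    ...   | no ¬d = ⊥-elim (twins-apart i≢j ¬d eq)

  induced-P6 : (v0 v1 v2 v3 v4 v5 : Fin n) →
    adj G v0 v1 ≡ true → adj G v0 v2 ≡ false → adj G v0 v3 ≡ false →
    adj G v0 v4 ≡ false → adj G v0 v5 ≡ false →
    adj G v1 v2 ≡ true → adj G v1 v3 ≡ false → adj G v1 v4 ≡ false →
    adj G v1 v5 ≡ false →
    adj G v2 v3 ≡ true → adj G v2 v4 ≡ false → adj G v2 v5 ≡ false →
    adj G v3 v4 ≡ true → adj G v3 v5 ≡ false →
    adj G v4 v5 ≡ true →
    InducedIn G All (P 6)
  induced-P6 v0 v1 v2 v3 v4 v5 e01 e02 e03 e04 e05 e12 e13 e14 e15 e23 e24 e25 e34 e35 e45 =
    induced-copy (P 6) f (preserves-from-upper (P 6) f upper)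
      (λ i≢j ¬d → ⊥-elim (¬d (P6-twinFree _ _ i≢j)))
    where
    f : Fin 6 → Fin n
    f = lookup (v0 ∷ v1 ∷ v2 ∷ v3 ∷ v4 ∷ v5 ∷ [])
    upper : ∀ i j → i < j → adj G (f i) (f j) ≡ adj (P 6) i j
    upper zero (suc zero) _ = e01
    upper zero (suc (suc zero)) _ = e02
    upper zero (suc (suc (suc zero))) _ = e03
    upper zero (suc (suc (suc (suc zero)))) _ = e04
    upper zero (suc (suc (suc (suc (suc zero))))) _ = e05
    upper (suc zero) (suc (suc zero)) _ = e12
    upper (suc zero) (suc (suc (suc zero))) _ = e13
    upper (suc zero) (suc (suc (suc (suc zero)))) _ = e14
    upper (suc zero) (suc (suc (suc (suc (suc zero))))) _ = e15
    upper (suc (suc zero)) (suc (suc (suc zero))) _ = e23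
    upper (suc (suc zero)) (suc (suc (suc (suc zero)))) _ = e24
    upper (suc (suc zero)) (suc (suc (suc (suc (suc zero))))) _ = e25
    upper (suc (suc (suc zero))) (suc (suc (suc (suc zero)))) _ = e34
    upper (suc (suc (suc zero))) (suc (suc (suc (suc (suc zero))))) _ = e35
    upper (suc (suc (suc (suc zero)))) (suc (suc (suc (suc (suc zero))))) _ = e45
    upper _ zero ()
    upper (suc _) (suc zero) (s≤s ())
    upper (suc (suc _)) (suc (suc zero)) (s≤s (s≤s ()))
    upper (suc (suc (suc _))) (suc (suc (suc zero))) (s≤s (s≤s (s≤s ())))
    upper (suc (suc (suc (suc _)))) (suc (suc (suc (suc zero)))) (s≤s (s≤s (s≤s (s≤s ()))))
    upper (suc (suc (suc (suc (suc _))))) (suc (suc (suc (suc (suc zero))))) (s≤s (s≤s (s≤s (s≤s (s≤s ())))))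

  induced-C4 : (v0 v1 v2 v3 : Fin n) →
    adj G v0 v1 ≡ true → adj G v0 v2 ≡ false → adj G v0 v3 ≡ true →
    adj G v1 v2 ≡ true → adj G v1 v3 ≡ false →
    adj G v2 v3 ≡ true →
    v0 ≢ v2 → v1 ≢ v3 →
    InducedIn G All C4
  induced-C4 v0 v1 v2 v3 e01 e02 e03 e12 e13 e23 v0≢v2 v1≢v3 =
    induced-copy C4 f (preserves-from-upper C4 f upper) twins-apart
    where
    f : Fin 4 → Fin n
    f = lookup (v0 ∷ v1 ∷ v2 ∷ v3 ∷ [])
    upper : ∀ i j → i < j → adj G (f i) (f j) ≡ adj C4 i j
    upper zero (suc zero) _ = e01
    upper zero (suc (suc zero)) _ = e02
    upper zero (suc (suc (suc zero))) _ = e03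
    upper (suc zero) (suc (suc zero)) _ = e12
    upper (suc zero) (suc (suc (suc zero))) _ = e13
    upper (suc (suc zero)) (suc (suc (suc zero))) _ = e23
    upper _ zero ()
    upper (suc _) (suc zero) (s≤s ())
    upper (suc (suc _)) (suc (suc zero)) (s≤s (s≤s ()))
    upper (suc (suc (suc _))) (suc (suc (suc zero))) (s≤s (s≤s (s≤s ())))
    opposite-apart : ∀ i → f i ≢ f (opposite i)
    opposite-apart zero = v0≢v2
    opposite-apart (suc zero) = v1≢v3
    opposite-apart (suc (suc zero)) = ≢-sym v0≢v2
    opposite-apart (suc (suc (suc zero))) = ≢-sym v1≢v3
    twins-apart : ∀ {i j} → i ≢ j → ¬ Distinguishable C4 i j → f i ≢ f j
    twins-apart {i} {j} i≢j ¬d with C4-twins i j i≢j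
    ... | inj₁ d = ⊥-elim (¬d d)
    ... | inj₂ refl = opposite-apart i

  reach-++ : ∀ {S u w v} → Reach G S u w → Reach G S w v → Reach G S u v
  reach-++ here r = r
  reach-++ (step uw w∈S r) r′ = step uw w∈S (reach-++ r r′)

  reach-reverse : ∀ {S u v} → u ∈ S → Reach G S u v → Reach G S v u
  reach-reverse u∈S here = here
  reach-reverse u∈S (step uw w∈S r) =
    reach-++ (reach-reverse w∈S r) (step (adj-sym uw) u∈S here)

  dominated-connected : ∀ {k} {S : Subset n} (f : Fin k → Fin n) →
    (∀ i → f i ∈ S) → (r : Fin k) → (∀ i → Reach G S (f r) (f i)) →
    (∀ u → u ∈ S → ∃ λ i → adj G u (f i) ≡ true) → Connected G S
  dominated-connected f f∈S r walk dominates u v u∈S v∈S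
    with dominates u u∈S | dominates v v∈S
  ... | i , u~fi | j , v~fj =
    step u~fi (f∈S i)
      (reach-++ (reach-reverse (f∈S r) (walk i))
        (reach-++ (walk j) (step (adj-sym v~fj) v∈S here)))

  neighbour-or-anticomplete : ∀ {k} (z : Fin n) (f : Fin k → Fin n) →
    (∃ λ i → adj G z (f i) ≡ true) ⊎ (∀ i → adj G z (f i) ≡ false)
  neighbour-or-anticomplete z f with any? (λ i → adj G z (f i) ≟ᵇ true)
  ... | yes hit = inj₁ hit
  ... | no miss = inj₂ λ i → ¬-not λ zfi → miss (i , zfi)

AnchorEdge : ∀ {n} → Graph n → Subset n → Subset n → Set
AnchorEdge {n} G X Y =
  Σ (Fin n) λ c′ → Σ (Fin n) λ c″ →
    c′ ∉ X × c′ ∉ Y × c″ ∉ X × c″ ∉ Y ×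
    (∀ y → y ∈ Y → adj G c′ y ≡ true) ×
    (∀ x → x ∈ X → adj G c′ x ≡ false) ×
    (∀ v → v ∈ X → adj G c″ v ≡ false) ×
    (∀ v → v ∈ Y → adj G c″ v ≡ false) ×
    adj G c′ c″ ≡ true

module Lemma-2-4 {n} (G : Graph n) (X Y : Subset n) (c : Fin n)
  (P6-free : Free G (P 6)) (C4-free : Free G C4)
  (X∩Y=∅ : ∀ v → v ∈ X → v ∉ Y) (c∉Y : c ∉ Y)
  (Y-clique : ∀ u v → u ∈ Y → v ∈ Y → u ≢ v → adj G u v ≡ true)
  (Y-neighbour : ∀ x → x ∈ X → Σ (Fin n) λ y → y ∈ Y × adj G x y ≡ true)
  (c~X : ∀ x → x ∈ X → adj G c x ≡ true)
  (c≁Y : ∀ y → y ∈ Y → adj G c y ≡ false) where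

  X-Y-apart : ∀ {x y} → x ∈ X → y ∈ Y → x ≢ y
  X-Y-apart x∈X y∈Y refl = X∩Y=∅ _ x∈X y∈Y

  -- Non-adjacent vertices of X have no common neighbour in Y:
  -- otherwise x′ c x y would be an induced C4.
  private-neighbour : ∀ {x x′ y} → x ∈ X → x′ ∈ X → x ≢ x′ →
    adj G x x′ ≡ false → y ∈ Y → adj G x y ≡ true → adj G x′ y ≡ false
  private-neighbour {x} {x′} {y} x∈X x′∈X x≢x′ x≁x′ y∈Y x~y with adj G x′ y in x′~y
  ... | false = refl
  ... | true = ⊥-elim (C4-free (induced-C4 G x′ c x y
          (adj-sym G (c~X x′ x′∈X)) (adj-sym G x≁x′) x′~y
          (c~X x x∈X) (c≁Y y y∈Y) x~y
          (≢-sym x≢x′) (λ { refl → c∉Y y∈Y })))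

  clique-edge : ∀ {w y y′} → y ∈ Y → y′ ∈ Y →
    adj G w y ≡ true → adj G w y′ ≡ false → adj G y y′ ≡ true
  clique-edge y∈Y y′∈Y wy wy′ = Y-clique _ _ y∈Y y′∈Y (separated G wy wy′)

  module InsideX {k} {H : Graph k} (copy : InducedIn G X H) where
    v : Fin k → Fin n
    v = proj₁ copy

    v-injective : Injective _≡_ _≡_ v
    v-injective = proj₁ (proj₂ copy)

    v∈X : ∀ i → v i ∈ X
    v∈X = proj₁ (proj₂ (proj₂ copy))

    v-adj : Preserves G H v
    v-adj = proj₂ (proj₂ (proj₂ copy))

    y-of : Fin k → Fin n
    y-of i = proj₁ (Y-neighbour (v i) (v∈X i))

    y-of∈Y : ∀ i → y-of i ∈ Y
    y-of∈Y i = proj₁ (proj₂ (Y-neighbour (v i) (v∈X i)))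

    v~y-of : ∀ i → adj G (v i) (y-of i) ≡ true
    v~y-of i = proj₂ (proj₂ (Y-neighbour (v i) (v∈X i)))

    private-along : ∀ i j → i ≢ j → adj H i j ≡ false → adj G (v j) (y-of i) ≡ false
    private-along i j i≢j i≁j = private-neighbour (v∈X i) (v∈X j)
      (λ eq → i≢j (v-injective eq)) (trans (v-adj i j) i≁j) (y-of∈Y i) (v~y-of i)

    far-Y-edge : ∀ i j → i ≢ j → adj H i j ≡ false → adj G (y-of i) (y-of j) ≡ true
    far-Y-edge i j i≢j i≁j = clique-edge (y-of∈Y i) (y-of∈Y j) (v~y-of i)
      (private-along j i (≢-sym i≢j) (trans (sym H j i) i≁j))

  module InducedP4InX (copy : InducedIn G X (P 4)) where
    open InsideX {H = P 4} copy

    i₀ i₁ i₂ i₃ : Fin 4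
    i₀ = zero
    i₁ = suc zero
    i₂ = suc (suc zero)
    i₃ = suc (suc (suc zero))

    y₀ y₃ : Fin n
    y₀ = y-of i₀
    y₃ = y-of i₃

    -- Otherwise a b y₃ v₃ v₂ v₁
    -- or a b y₀ v₀ v₁ v₂ is an induced P6, or else y₀ v₁ v₂ y₃ is a C4.
    no-pendant-edge : ∀ a b → adj G a b ≡ true →
      adj G b y₀ ≡ true → adj G b y₃ ≡ true →
      adj G a y₀ ≡ false → adj G a y₃ ≡ false →
      (∀ i → adj G a (v i) ≡ false) → (∀ i → adj G b (v i) ≡ false) → ⊥
    no-pendant-edge a b ab by₀ by₃ ay₀ ay₃ a≁v b≁v with adj G y₃ (v i₂) in y₃v₂
    ... | false = P6-free (induced-P6 G a b y₃ (v i₃) (v i₂) (v i₁)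
          ab ay₃ (a≁v i₃) (a≁v i₂) (a≁v i₁) by₃ (b≁v i₃) (b≁v i₂) (b≁v i₁)
          (adj-sym G (v~y-of i₃)) y₃v₂ (adj-sym G (private-along i₃ i₁ (λ ()) refl))
          (v-adj i₃ i₂) (v-adj i₃ i₁) (v-adj i₂ i₁))
    ... | true with adj G y₀ (v i₁) in y₀v₁
    ...   | false = P6-free (induced-P6 G a b y₀ (v i₀) (v i₁) (v i₂)
            ab ay₀ (a≁v i₀) (a≁v i₁) (a≁v i₂) by₀ (b≁v i₀) (b≁v i₁) (b≁v i₂)
            (adj-sym G (v~y-of i₀)) y₀v₁ (adj-sym G (private-along i₀ i₂ (λ ()) refl))
            (v-adj i₀ i₁) (v-adj i₀ i₂) (v-adj i₁ i₂))
    ...   | true = C4-free (induced-C4 G y₀ (v i₁) (v i₂) y₃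
            y₀v₁ (adj-sym G (private-along i₀ i₂ (λ ()) refl)) (far-Y-edge i₀ i₃ (λ ()) refl)
            (v-adj i₁ i₂) (private-along i₃ i₁ (λ ()) refl) (adj-sym G y₃v₂)
            (≢-sym (X-Y-apart (v∈X i₂) (y-of∈Y i₀))) (X-Y-apart (v∈X i₁) (y-of∈Y i₃)))

    no-anchor-edge : AnchorEdge G X Y → ⊥
    no-anchor-edge (c′ , c″ , _ , _ , _ , _ , c′~Y , c′≁X , c″≁X , c″≁Y , c′c″) =
      no-pendant-edge c″ c′ (adj-sym G c′c″)
        (c′~Y y₀ (y-of∈Y i₀)) (c′~Y y₃ (y-of∈Y i₃))
        (c″≁Y y₀ (y-of∈Y i₀)) (c″≁Y y₃ (y-of∈Y i₃))
        (λ i → c″≁X (v i) (v∈X i)) (λ i → c′≁X (v i) (v∈X i))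

    -- So would be the edge from a vertex z ∈ X anticomplete to the path to
    -- its Y-neighbour: the path dominates X.
    dominates : ∀ z → z ∈ X → ∃ λ i → adj G z (v i) ≡ true
    dominates z z∈X with neighbour-or-anticomplete G z v
    ... | inj₁ hit = hit
    ... | inj₂ z≁v = ⊥-elim (no-pendant-edge z y z~y
          (adj-sym G (clique-edge (y-of∈Y i₀) y∈Y (v~y-of i₀) (v≁y i₀)))
          (adj-sym G (clique-edge (y-of∈Y i₃) y∈Y (v~y-of i₃) (v≁y i₃)))
          (z≁y-of i₀) (z≁y-of i₃) z≁v (λ i → adj-sym G (v≁y i)))
      where
      y : Fin n
      y = proj₁ (Y-neighbour z z∈X)
      y∈Y : y ∈ Y
      y∈Y = proj₁ (proj₂ (Y-neighbour z z∈X))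
      z~y : adj G z y ≡ true
      z~y = proj₂ (proj₂ (Y-neighbour z z∈X))
      -- each v i has a neighbour on the path, which z misses
      z≢v : ∀ i → z ≢ v i
      z≢v i with P4-no-isolated i
      ... | j , j~i = ≢-sym (separated G (trans (v-adj j i) j~i) (adj-sym G (z≁v j)))
      v≁y : ∀ i → adj G (v i) y ≡ false
      v≁y i = private-neighbour z∈X (v∈X i) (z≢v i) (z≁v i) y∈Y z~y
      z≁y-of : ∀ i → adj G z (y-of i) ≡ false
      z≁y-of i = private-neighbour (v∈X i) z∈X (≢-sym (z≢v i))
        (adj-sym G (z≁v i)) (y-of∈Y i) (v~y-of i)

    X-connected : Connected G X
    X-connected = dominated-connected G v v∈X i₀ walk dominates
      where
      walk : ∀ i → Reach G X (v i₀) (v i)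
      walk zero = here
      walk (suc zero) = step (v-adj i₀ i₁) (v∈X i₁) here
      walk (suc (suc zero)) =
        step (v-adj i₀ i₁) (v∈X i₁) (step (v-adj i₁ i₂) (v∈X i₂) here)
      walk (suc (suc (suc zero))) =
        step (v-adj i₀ i₁) (v∈X i₁) (step (v-adj i₁ i₂) (v∈X i₂)
          (step (v-adj i₂ i₃) (v∈X i₃) here))

  -- Two induced paths v₀ v₁ v₂ and v₃ v₄ v₅ in G[X], with no edges between
  -- them, are impossible: with y₀ = y-of 0 and y₅ = y-of 5 (adjacent by
  -- far-Y-edge), take on each side the edge closest to the Y-neighbour
  -- (v₂v₁ if y₀ ~ v₁, else v₁v₀; v₄v₃ if y₅ ~ v₄, else v₅v₄); the two edges
  -- joined through y₀y₅ form an induced P6.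
  module Induced2P3InX (copy : InducedIn G X twoP3) where
    open InsideX {H = twoP3} copy

    i₀ i₁ i₂ i₃ i₄ i₅ : Fin 6
    i₀ = zero
    i₁ = suc zero
    i₂ = suc (suc zero)
    i₃ = suc (suc (suc zero))
    i₄ = suc (suc (suc (suc zero)))
    i₅ = suc (suc (suc (suc (suc zero))))

    y₀ y₅ : Fin n
    y₀ = y-of i₀
    y₅ = y-of i₅

    absurd : ⊥
    absurd with adj G y₀ (v i₁) in y₀v₁ | adj G y₅ (v i₄) in y₅v₄
    ... | false | false = P6-free (induced-P6 G (v i₁) (v i₀) y₀ y₅ (v i₅) (v i₄)
          (v-adj i₁ i₀) (adj-sym G y₀v₁) (private-along i₅ i₁ (λ ()) refl)
          (v-adj i₁ i₅) (v-adj i₁ i₄)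
          (v~y-of i₀) (private-along i₅ i₀ (λ ()) refl) (v-adj i₀ i₅) (v-adj i₀ i₄)
          (far-Y-edge i₀ i₅ (λ ()) refl) (adj-sym G (private-along i₀ i₅ (λ ()) refl))
          (adj-sym G (private-along i₀ i₄ (λ ()) refl))
          (adj-sym G (v~y-of i₅)) y₅v₄
          (v-adj i₅ i₄))
    ... | true | false = P6-free (induced-P6 G (v i₂) (v i₁) y₀ y₅ (v i₅) (v i₄)
          (v-adj i₂ i₁) (private-along i₀ i₂ (λ ()) refl) (private-along i₅ i₂ (λ ()) refl)
          (v-adj i₂ i₅) (v-adj i₂ i₄)
          (adj-sym G y₀v₁) (private-along i₅ i₁ (λ ()) refl) (v-adj i₁ i₅) (v-adj i₁ i₄)
          (far-Y-edge i₀ i₅ (λ ()) refl) (adj-sym G (private-along i₀ i₅ (λ ()) refl))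
          (adj-sym G (private-along i₀ i₄ (λ ()) refl))
          (adj-sym G (v~y-of i₅)) y₅v₄
          (v-adj i₅ i₄))
    ... | false | true = P6-free (induced-P6 G (v i₁) (v i₀) y₀ y₅ (v i₄) (v i₃)
          (v-adj i₁ i₀) (adj-sym G y₀v₁) (private-along i₅ i₁ (λ ()) refl)
          (v-adj i₁ i₄) (v-adj i₁ i₃)
          (v~y-of i₀) (private-along i₅ i₀ (λ ()) refl) (v-adj i₀ i₄) (v-adj i₀ i₃)
          (far-Y-edge i₀ i₅ (λ ()) refl) (adj-sym G (private-along i₀ i₄ (λ ()) refl))
          (adj-sym G (private-along i₀ i₃ (λ ()) refl))
          y₅v₄ (adj-sym G (private-along i₅ i₃ (λ ()) refl))
          (v-adj i₄ i₃))
    ... | true | true = P6-free (induced-P6 G (v i₂) (v i₁) y₀ y₅ (v i₄) (v i₃)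
          (v-adj i₂ i₁) (private-along i₀ i₂ (λ ()) refl) (private-along i₅ i₂ (λ ()) refl)
          (v-adj i₂ i₄) (v-adj i₂ i₃)
          (adj-sym G y₀v₁) (private-along i₅ i₁ (λ ()) refl) (v-adj i₁ i₄) (v-adj i₁ i₃)
          (far-Y-edge i₀ i₅ (λ ()) refl) (adj-sym G (private-along i₀ i₄ (λ ()) refl))
          (adj-sym G (private-along i₀ i₃ (λ ()) refl))
          y₅v₄ (adj-sym G (private-along i₅ i₃ (λ ()) refl))
          (v-adj i₄ i₃))

lemma2p4 : ∀ {n} (G : Graph n) (X Y : Subset n) (c : Fin n) →
    Free G (P 6) → Free G C4 →
    (∀ v → v ∈ X → v ∉ Y) → c ∉ X → c ∉ Y →
    (∀ u v → u ∈ Y → v ∈ Y → u ≢ v → adj G u v ≡ true) →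
    (∀ x → x ∈ X → Σ (Fin n) λ y → y ∈ Y × adj G x y ≡ true) →
    (∀ x → x ∈ X → adj G c x ≡ true) →
    (∀ y → y ∈ Y → adj G c y ≡ false) →
    (¬ Connected G X
      ⊎ Σ (Fin n) λ c′ → Σ (Fin n) λ c″ →
          c′ ∉ X × c′ ∉ Y × c″ ∉ X × c″ ∉ Y ×
          (∀ y → y ∈ Y → adj G c′ y ≡ true) ×
          (∀ x → x ∈ X → adj G c′ x ≡ false) ×
          (∀ v → v ∈ X → adj G c″ v ≡ false) ×
          (∀ v → v ∈ Y → adj G c″ v ≡ false) ×
          adj G c′ c″ ≡ true) →
    FreeIn G X (P 4) × FreeIn G X twoP3
lemma2p4 G X Y c P6-free C4-free X∩Y=∅ _ c∉Y Y-clique Y-neighbour c~X c≁Y alternative =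
  P4-free alternative , λ copy → Induced2P3InX.absurd copy
  where
  open Lemma-2-4 G X Y c P6-free C4-free X∩Y=∅ c∉Y Y-clique Y-neighbour c~X c≁Y

  P4-free : ¬ Connected G X ⊎ AnchorEdge G X Y → FreeIn G X (P 4)
  P4-free (inj₁ disconnected) copy = disconnected (InducedP4InX.X-connected copy)
  P4-free (inj₂ anchor) copy = InducedP4InX.no-anchor-edge copy anchor
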